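{- Let $p$ and $k$ be integers with $p>5$ and $p+2\leq k<p^2-3p+2$. Define $f:\mathbb{Z}_{\geq 0}\to\mathbb{Z}_{\geq 0}$ by $$f(x)=\begin{cases}\dfrac{(x+p-1)(x+2p-1)}{p^2}, & x\equiv 1 \pmod p,\\[2mm] \dfrac{x+p-j}{p}, & x\equiv j \pmod p,\ 2\leq j\leq p-1,\\[2mm] \dfrac{x}{p}, & x\equiv 0\pmod p.\end{cases}$$ Let $n$ be a positive integer with base-$k$ expansion $n=a_{m-1}k^{m-1}+\dots+a_1k+a_0$ (digits $0\leq a_i<k$, $a_{m-1}\neq 0$), so $n$ has $m$ digits in base $k$, and let $\mathcal{Z}_k(n)=\sum_{i=0}^{m-1}f(a_i)$. If $m\geq 3$, then $\mathcal{Z}_k(n)<k^{m-1}$, i.e., $\mathcal{Z}_k(n)$ has at most $m-1$ digits in base $k$.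
   Context: $\mathcal{Z}_k$ is called the $\mathcal{Z}$ transformation in base $k$. -}

module Defs where

open import Data.Nat using (ℕ; zero; suc; _+_; _*_; _∸_; _^_; _<_; _≤_; NonZero)
open import Data.Nat.DivMod using (_/_; _%_)
open import Data.Nat.Properties using (m*n≢0)
open import Data.List using (List; []; _∷_; map; length)
open import Data.Nat.ListAction using (sum)

-- For x ≡ 1 (mod p): (x+p-1)(x+2p-1)/p² ; x ≡ 0: x/p ; x ≡ j (2 ≤ j ≤ p-1): (x+p-j)/p.
-- All divisions are exact in the respective cases.
f : (p : ℕ) → .{{_ : NonZero p}} → ℕ → ℕ
f p x with x % p
... | 0 = x / p
... | 1 = ((x + p ∸ 1) * (x + 2 * p ∸ 1)) / (p * p)
  where instance _ : NonZero (p * p)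
                 _ = m*n≢0 p p
... | suc (suc i) = (x + p ∸ suc (suc i)) / p

-- base-k digits of n, least significant first (fuel-bounded; fuel n suffices for k ≥ 2)
digitsAux : ℕ → (k : ℕ) → .{{_ : NonZero k}} → ℕ → List ℕ
digitsAux zero    k n = []
digitsAux (suc t) k zero = []
digitsAux (suc t) k n@(suc _) = (n % k) ∷ digitsAux t k (n / k)

digits : (k : ℕ) → .{{_ : NonZero k}} → ℕ → List ℕ
digits k n = digitsAux n k n

numDigits : (k : ℕ) → .{{_ : NonZero k}} → ℕ → ℕ
numDigits k n = length (digits k n)

Z : (p k : ℕ) → .{{_ : NonZero p}} → .{{_ : NonZero k}} → ℕ → ℕ
Z p k n = sum (map (f p) (digits k n))

module Submission where

-- Every base-k digit x satisfies x < k < p² − 3p + 2, and on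
-- that range the map f never exceeds x + 1 (lemma f≤suc):
--   * for x ≡ 0 and x ≡ j ≥ 2 (mod p), f x is at most (x + p)/p ≤ x + 1;
--   * for x = 1 + jp, f x = (j+1)(j+2), and x < p² − 3p + 2 forces
--     jp ≤ p(p − 3), i.e. j + 3 ≤ p, whence (j+1)(j+2) = 2 + j(j+3) ≤ 2 + jp = x + 1.
-- So every term of Z_k(n) is at most k, and Z_k(n) ≤ m·k where m is the
-- number of digits.  Finally m·k < k^(m−1) as soon as m ≥ 3 and k ≥ 4
-- (lemma digitCount*base<power), and k ≥ p + 2 > 4 by hypothesis.

open import Defs
open import Data.Nat using (ℕ; _+_; _*_; _∸_; _^_; _<_; _≤_; NonZero; suc; zero; z≤n; s≤s)
open import Data.Nat.Properties
open import Data.Nat.DivMod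
open import Data.Nat.ListAction using (sum)
open import Data.List using (List; []; _∷_; map; length)
open import Data.List.Relation.Unary.All as All using (All; []; _∷_)
open import Relation.Binary.PropositionalEquality
open import Data.Nat.Solver using (module +-*-Solver)
open +-*-Solver using (solve; _:+_; _:*_; _:=_; con)
open ≤-Reasoning

-- If j·p ≤ p² − 3p (and 3 ≤ p) then j + 3 ≤ p, since (j + 3)·p ≤ p².
quotient+3≤ : ∀ p j .{{_ : NonZero p}} → 3 ≤ p → j * p ≤ p * p ∸ 3 * p → j + 3 ≤ p
quotient+3≤ p j 3≤p jp≤p²∸3p = *-cancelʳ-≤ (j + 3) p p (begin
  (j + 3) * p           ≡⟨ *-distribʳ-+ p j 3 ⟩
  j * p + 3 * p         ≤⟨ +-monoˡ-≤ (3 * p) jp≤p²∸3p ⟩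
  p * p ∸ 3 * p + 3 * p ≡⟨ m∸n+n≡m (*-monoˡ-≤ p 3≤p) ⟩
  p * p                 ∎)

-- At x = 1 + jp the numerator of f is (jp + p)(jp + 2p) = (j+1)(j+2)·p².
quadratic-numerator : ∀ j p → (j * p + p) * (j * p + 2 * p) ≡ (suc j * suc (suc j)) * (p * p)
quadratic-numerator = solve 2 (λ j p → (j :* p :+ p) :* (j :* p :+ con 2 :* p)
                               := ((con 1 :+ j) :* (con 2 :+ j)) :* (p :* p)) refl

-- (j+1)(j+2) = 2 + j(j+3), which compares with 2 + jp = x + 1 when j + 3 ≤ p.
consecutive-product : ∀ j → suc j * suc (suc j) ≡ 2 + j * (j + 3)
consecutive-product = solve 1 (λ j → (con 1 :+ j) :* (con 2 :+ j)
                               := con 2 :+ j :* (j :+ con 3)) refl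

quadratic-branch≤ : ∀ p j .{{_ : NonZero (p * p)}} → j + 3 ≤ p →
                    ((j * p + p) * (j * p + 2 * p)) / (p * p) ≤ suc (suc (j * p))
quadratic-branch≤ p j j+3≤p = begin
  ((j * p + p) * (j * p + 2 * p)) / (p * p)   ≡⟨ cong (_/ (p * p)) (quadratic-numerator j p) ⟩
  ((suc j * suc (suc j)) * (p * p)) / (p * p) ≡⟨ m*n/n≡m _ (p * p) ⟩
  suc j * suc (suc j)                         ≡⟨ consecutive-product j ⟩
  2 + j * (j + 3)                             ≤⟨ +-monoʳ-≤ 2 (*-monoʳ-≤ j j+3≤p) ⟩
  2 + j * p                                   ∎

shifted-quotient≤ : ∀ p s x .{{_ : NonZero p}} → (x + p ∸ s) / p ≤ suc x
shifted-quotient≤ p s x = begin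
  (x + p ∸ s) / p ≤⟨ /-monoˡ-≤ p (m∸n≤m (x + p) s) ⟩
  (x + p) / p     ≤⟨ /-monoˡ-≤ p (+-monoˡ-≤ p (m≤m*n x p)) ⟩
  (x * p + p) / p ≡⟨ cong (_/ p) (+-comm (x * p) p) ⟩
  (suc x * p) / p ≡⟨ m*n/n≡m (suc x) p ⟩
  suc x           ∎

f≤suc : (p : ℕ) .{{_ : NonZero p}} → 3 ≤ p → (x : ℕ) → x < p * p ∸ 3 * p + 2 → f p x ≤ suc x
f≤suc p 3≤p x x<bound with x % p in x%p≡
... | 0           = ≤-trans (m/n≤m x p) (n≤1+n x)
... | suc (suc i) = shifted-quotient≤ p (suc (suc i)) x
... | 1           = subst (λ y → ((y + p ∸ 1) * (y + 2 * p ∸ 1)) / (p * p) ≤ suc y)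
                          (sym x≡1+jp) (quadratic-branch≤ p j (quotient+3≤ p j 3≤p jp≤p²∸3p))
  where
    instance _ : NonZero (p * p)
             _ = m*n≢0 p p
    j = x / p
    x≡1+jp : x ≡ 1 + j * p
    x≡1+jp = trans (m≡m%n+[m/n]*n x p) (cong (_+ j * p) x%p≡)
    jp≤p²∸3p : j * p ≤ p * p ∸ 3 * p
    jp≤p²∸3p = ≤-pred (≤-pred (subst₂ _≤_ (cong suc x≡1+jp) (+-comm (p * p ∸ 3 * p) 2) x<bound))

sum-bounded : ∀ {A : Set} (g : A → ℕ) (c : ℕ) (xs : List A) →
              All (λ x → g x ≤ c) xs → sum (map g xs) ≤ length xs * c
sum-bounded g c []       []         = z≤n
sum-bounded g c (x ∷ xs) (gx≤c ∷ h) = +-mono-≤ gx≤c (sum-bounded g c xs h)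

digits<base : ∀ t k .{{_ : NonZero k}} n → All (_< k) (digitsAux t k n)
digits<base zero    k n         = []
digits<base (suc t) k zero      = []
digits<base (suc t) k n@(suc _) = m%n<n n k ∷ digits<base t k (n / k)

3+t<power : ∀ k t → 4 ≤ k → 3 + t < k ^ (1 + t)
3+t<power k zero    4≤k = subst (3 <_) (sym (*-identityʳ k)) 4≤k
3+t<power k (suc t) 4≤k = begin-strict
    4 + t  <⟨ s≤s ih ⟩
    suc P  ≤⟨ +-monoˡ-≤ P (≤-trans (s≤s z≤n) ih) ⟩
    P + P  ≡⟨ cong (P +_) (sym (+-identityʳ P)) ⟩
    2 * P  ≤⟨ *-monoˡ-≤ P (≤-trans (s≤s (s≤s z≤n)) 4≤k) ⟩
    k * P  ∎
  where
    P = k ^ (1 + t)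
    ih = 3+t<power k t 4≤k

digitCount*base<power : ∀ k m .{{_ : NonZero k}} → 4 ≤ k → 3 ≤ m → m * k < k ^ (m ∸ 1)
digitCount*base<power k (suc (suc (suc t))) 4≤k (s≤s (s≤s (s≤s _))) = begin-strict
  (3 + t) * k       <⟨ *-monoˡ-< k (3+t<power k t 4≤k) ⟩
  k ^ (1 + t) * k   ≡⟨ *-comm _ k ⟩
  k ^ (2 + t)       ∎

lemma2 : (p k : ℕ) → .{{_ : NonZero p}} → .{{_ : NonZero k}} →
         5 < p → p + 2 ≤ k → k < p * p ∸ 3 * p + 2 →
         (n : ℕ) → 0 < n → 3 ≤ numDigits k n →
         Z p k n < k ^ (numDigits k n ∸ 1)
lemma2 p k 5<p p+2≤k k<bound n _ 3≤m = begin-strict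
  Z p k n               ≤⟨ sum-bounded (f p) k (digits k n) (All.map f-digit≤k (digits<base n k n)) ⟩
  numDigits k n * k     <⟨ digitCount*base<power k (numDigits k n) 4≤k 3≤m ⟩
  k ^ (numDigits k n ∸ 1) ∎
  where
    4≤p : 4 ≤ p
    4≤p = ≤-trans (n≤1+n 4) (<⇒≤ 5<p)
    3≤p : 3 ≤ p
    3≤p = ≤-trans (n≤1+n 3) 4≤p
    4≤k : 4 ≤ k
    4≤k = ≤-trans 4≤p (≤-trans (m≤m+n p 2) p+2≤k)
    f-digit≤k : ∀ {x} → x < k → f p x ≤ k
    f-digit≤k x<k = ≤-trans (f≤suc p 3≤p _ (<-trans x<k k<bound)) x<k
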